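{- The $k$-deck of an unknown binary string $x\in\{0,1\}^n$ can be determined exactly, with high probability, from $\exp(O(k\log n))$ traces of $x$ from the symmetric deletion channel with deletion probability $p\le 1-k/n$.
   Context: The $k$-deck of a string is the multiset of all its length-$k$ subsequences (one for each $k$-subset of positions). The symmetric deletion channel with deletion probability $p$ deletes each coordinate independently with probability $p$ and outputs the subsequence of surviving coordinates; each output is a trace. "With high probability" means with probability at least $1-o(1)$ as $n\to\infty$.
   Formalization: The deletion probability p takes only rational values, ranging over the rationals between 0 and 1 − k/n. -}

module Defs where

open import Data.Bool using (Bool; true; false; if_then_else_)
open import Data.Nat using (ℕ; zero; suc; _≡ᵇ_)
open import Data.List using (List; []; _∷_; _++_; map; foldr)
open import Data.Vec using (Vec; []; _∷_; toList)
import Data.Vec as Vec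
open import Data.Rational using (ℚ; 0ℚ; 1ℚ; _+_; _*_; _-_)

allVecs : (n : ℕ) → List (Vec Bool n)
allVecs zero    = [] ∷ []
allVecs (suc n) = map (true ∷_) (allVecs n) ++ map (false ∷_) (allVecs n)

tuples : {A : Set} → List A → (T : ℕ) → List (Vec A T)
tuples xs zero    = [] ∷ []
tuples xs (suc T) = foldr (λ a acc → map (a ∷_) (tuples xs T) ++ acc) [] xs

subseq : {A : Set} {n : ℕ} → Vec Bool n → Vec A n → List A
subseq []           []       = []
subseq (true ∷ s)  (a ∷ x)  = a ∷ subseq s x
subseq (false ∷ s) (a ∷ x)  = subseq s x

eqBits : List Bool → List Bool → Bool
eqBits []          []          = true
eqBits (true ∷ u)  (true ∷ v)  = eqBits u v
eqBits (false ∷ u) (false ∷ v) = eqBits u v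
eqBits _           _           = false

allB : {A : Set} → (A → Bool) → List A → Bool
allB P []       = true
allB P (a ∷ as) = if P a then allB P as else false

count : {A : Set} → (A → Bool) → List A → ℕ
count P []       = 0
count P (a ∷ as) = if P a then suc (count P as) else count P as

-- The k-deck of x, as a multiset over {0,1}^k given by multiplicities:
-- deck k x w = number of k-subsets S of positions (masks) with x|_S = w.
-- (A mask whose subsequence equals w, of length k, has exactly k selected
-- positions, so this counts exactly the k-subsets of positions.)
deck : (k : ℕ) {n : ℕ} → Vec Bool n → Vec Bool k → ℕ
deck k x w = count (λ s → eqBits (subseq s x) (toList w)) (allVecs _)

-- Probability that the symmetric deletion channel with deletion probability p
-- realises the survival mask s (true = survives, probability 1 - p).
maskProb : (p : ℚ) {n : ℕ} → Vec Bool n → ℚ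
maskProb p []          = 1ℚ
maskProb p (true ∷ s)  = (1ℚ - p) * maskProb p s
maskProb p (false ∷ s) = p * maskProb p s

masksProb : (p : ℚ) {n T : ℕ} → Vec (Vec Bool n) T → ℚ
masksProb p []       = 1ℚ
masksProb p (s ∷ ss) = maskProb p s * masksProb p ss

sumℚ : List ℚ → ℚ
sumℚ = foldr _+_ 0ℚ

Estimator : (k T : ℕ) → Set
Estimator k T = Vec (List Bool) T → Vec Bool k → ℕ

correct : (k : ℕ) {n : ℕ} → (Vec Bool k → ℕ) → Vec Bool n → Bool
correct k d x = allB (λ w → d w ≡ᵇ deck k x w) (allVecs k)

successProb : (n k : ℕ) (p : ℚ) (T : ℕ) → Estimator k T → Vec Bool n → ℚ
successProb n k p T est x =
  sumℚ (map (λ ss → if correct k (est (Vec.map (λ s → subseq s x) ss)) x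
                      then masksProb p ss else 0ℚ)
            (tuples (allVecs n) T))

-- The multiplicity of w in the k-deck of x is the number of occurrences of w as a subsequence of x,
-- and each occurrence survives the channel with probability (1 - p) ^ k, so the number of occurrences
-- of w in a trace has mean (1 - p) ^ k times that multiplicity.  Summing over T independent traces and
-- rounding to the nearest multiple of T (1 - p) ^ k recovers the multiplicity unless the sum is off by
-- T (1 - p) ^ k / 2; as every count is at most n ^ k, Chebyshev's inequality bounds the probability of
-- this by 4 n ^ 2k / (T (1 - p) ^ 2k).  Since (1 - p) n ≥ k ≥ 1, taking T = n ^ 6k traces and a union
-- bound over the 2 ^ k words leaves a failure probability of at most 4 · 2 ^ k / n ^ 2k ≤ 4 / n.
-- For k = 0 the deck is known without any trace.

module Submission where

module Arithmetic where

  open import Data.Empty using (⊥-elim)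
  import Data.Integer as ℤ
  import Data.Integer.Properties as ℤₚ
  open import Data.Nat as ℕ using (ℕ; zero; suc; z≤n; s≤s)
  import Data.Nat.Properties as ℕₚ
  open import Data.Product using (∃; _,_)
  open import Data.Rational
  open import Data.Rational.Properties
  open import Data.Rational.Solver using (module +-*-Solver)
  open import Data.Rational.Unnormalised as ℚᵘ using (mkℚᵘ)
  import Data.Rational.Unnormalised.Properties as ℚᵘₚ
  open import Data.Sum using (inj₁; inj₂)
  open import Relation.Binary.PropositionalEquality
  open import Relation.Nullary using (yes; no)
  open +-*-Solver using (solve; _:+_; _:*_; _:-_; :-_; _:=_; con)

  fromℕ : ℕ → ℚ
  fromℕ zero    = 0ℚ
  fromℕ (suc m) = 1ℚ + fromℕ m

  fromℕ-+ : ∀ m k → fromℕ (m ℕ.+ k) ≡ fromℕ m + fromℕ k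
  fromℕ-+ zero    k = sym (+-identityˡ (fromℕ k))
  fromℕ-+ (suc m) k = trans (cong (1ℚ +_) (fromℕ-+ m k)) (sym (+-assoc 1ℚ (fromℕ m) (fromℕ k)))

  fromℕ-* : ∀ m k → fromℕ (m ℕ.* k) ≡ fromℕ m * fromℕ k
  fromℕ-* zero    k = sym (*-zeroˡ (fromℕ k))
  fromℕ-* (suc m) k = begin
    fromℕ (k ℕ.+ m ℕ.* k)          ≡⟨ fromℕ-+ k (m ℕ.* k) ⟩
    fromℕ k + fromℕ (m ℕ.* k)      ≡⟨ cong (fromℕ k +_) (fromℕ-* m k) ⟩
    fromℕ k + fromℕ m * fromℕ k    ≡⟨ distrib (fromℕ m) (fromℕ k) ⟩
    (1ℚ + fromℕ m) * fromℕ k       ∎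
    where
    open ≡-Reasoning
    distrib : ∀ a b → b + a * b ≡ (1ℚ + a) * b
    distrib = solve 2 (λ a b → b :+ a :* b := (con 1ℚ :+ a) :* b) refl

  0≤1 : 0ℚ ≤ 1ℚ
  0≤1 = <⇒≤ (positive⁻¹ 1ℚ)

  0≤fromℕ : ∀ m → 0ℚ ≤ fromℕ m
  0≤fromℕ zero    = ≤-refl
  0≤fromℕ (suc m) = +-mono-≤ 0≤1 (0≤fromℕ m)

  fromℕ-mono-≤ : ∀ {m k} → m ℕ.≤ k → fromℕ m ≤ fromℕ k
  fromℕ-mono-≤ {k = k} z≤n = 0≤fromℕ k
  fromℕ-mono-≤ (s≤s m≤k)   = +-monoʳ-≤ 1ℚ (fromℕ-mono-≤ m≤k)

  *-monoˡ-≤′ : ∀ {a b} r → 0ℚ ≤ r → a ≤ b → r * a ≤ r * b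
  *-monoˡ-≤′ r 0≤r = *-monoˡ-≤-nonNeg r {{nonNegative 0≤r}}

  *-monoʳ-≤′ : ∀ {a b} r → 0ℚ ≤ r → a ≤ b → a * r ≤ b * r
  *-monoʳ-≤′ r 0≤r = *-monoʳ-≤-nonNeg r {{nonNegative 0≤r}}

  0≤* : ∀ {a b} → 0ℚ ≤ a → 0ℚ ≤ b → 0ℚ ≤ a * b
  0≤* {a} 0≤a 0≤b = subst (_≤ a * _) (*-zeroʳ a) (*-monoˡ-≤′ a 0≤a 0≤b)

  0<* : ∀ {a b} → 0ℚ < a → 0ℚ < b → 0ℚ < a * b
  0<* {a} {b} 0<a 0<b = positive⁻¹ (a * b) {{pos*pos⇒pos a {{positive 0<a}} b {{positive 0<b}}}}

  2ℚ : ℚ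
  2ℚ = 1ℚ + 1ℚ

  infixl 9 _²
  _² : ℚ → ℚ
  a ² = a * a

  0≤² : ∀ a → 0ℚ ≤ a ²
  0≤² a with ≤-total 0ℚ a
  ... | inj₁ 0≤a = 0≤* 0≤a 0≤a
  ... | inj₂ a≤0 = subst (0ℚ ≤_) (neg² a) (0≤* (neg-antimono-≤ a≤0) (neg-antimono-≤ a≤0))
    where
    neg² : ∀ a → (- a) * (- a) ≡ a * a
    neg² = solve 1 (λ a → (:- a) :* (:- a) := a :* a) refl

  p≤q⇒0≤q-p : ∀ {p q} → p ≤ q → 0ℚ ≤ q - p
  p≤q⇒0≤q-p {p} {q} p≤q = subst (_≤ q - p) (+-inverseʳ p) (+-monoˡ-≤ (- p) p≤q)

  0≤q-p⇒p≤q : ∀ {p q} → 0ℚ ≤ q - p → p ≤ q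
  0≤q-p⇒p≤q {p} {q} 0≤q-p = subst₂ _≤_ (+-identityˡ p) (cancel p q) (+-monoˡ-≤ p 0≤q-p)
    where
    cancel : ∀ p q → q - p + p ≡ q
    cancel = solve 2 (λ p q → q :- p :+ p := q) refl

  0≤p⇒1-p≤1 : ∀ {p} → 0ℚ ≤ p → 1ℚ - p ≤ 1ℚ
  0≤p⇒1-p≤1 {p} 0≤p = subst (1ℚ - p ≤_) (+-identityʳ 1ℚ) (+-monoʳ-≤ 1ℚ (neg-antimono-≤ 0≤p))

  ²-<⇒< : ∀ {u y} → 0ℚ ≤ y → u ² < y ² → u < y
  ²-<⇒< {u} {y} 0≤y u²<y² with u <? y
  ... | yes u<y = u<y
  ... | no  u≮y = ⊥-elim (<-irrefl refl (<-≤-trans u²<y² y²≤u²))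
    where
    y≤u : y ≤ u
    y≤u = ≮⇒≥ u≮y
    y²≤u² : y ² ≤ u ²
    y²≤u² = ≤-trans (*-monoˡ-≤′ y 0≤y y≤u) (*-monoʳ-≤′ u (≤-trans 0≤y y≤u) y≤u)

  -- (B - u + v)(B - v + u) = B² - (u - v)² with both factors nonnegative.
  ²-diff-≤ : ∀ {u v B} → 0ℚ ≤ u → u ≤ B → 0ℚ ≤ v → v ≤ B → (u - v) ² ≤ B ²
  ²-diff-≤ {u} {v} {B} 0≤u u≤B 0≤v v≤B =
    0≤q-p⇒p≤q (subst (0ℚ ≤_) (factor u v B)
                      (0≤* (+-mono-≤ (p≤q⇒0≤q-p u≤B) 0≤v) (+-mono-≤ (p≤q⇒0≤q-p v≤B) 0≤u)))
    where
    factor : ∀ u v B → (B - u + v) * (B - v + u) ≡ B * B - (u - v) * (u - v)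
    factor = solve 3 (λ u v B → (B :- u :+ v) :* (B :- v :+ u) := B :* B :- (u :- v) :* (u :- v)) refl

  1≤*⇒0< : ∀ {a c} → 0ℚ ≤ c → 1ℚ ≤ a * c → 0ℚ < a
  1≤*⇒0< {a} {c} 0≤c 1≤ac with 0ℚ <? a
  ... | yes 0<a = 0<a
  ... | no  0≮a = ⊥-elim (<-irrefl refl (<-≤-trans (positive⁻¹ 1ℚ) (≤-trans 1≤ac ac≤0)))
    where
    ac≤0 : a * c ≤ 0ℚ
    ac≤0 = subst (a * c ≤_) (*-zeroˡ c) (*-monoʳ-≤′ c 0≤c (≮⇒≥ 0≮a))

  infixr 8 _^_
  _^_ : ℚ → ℕ → ℚ
  a ^ zero  = 1ℚ
  a ^ suc k = a * a ^ k

  0≤^ : ∀ {a} k → 0ℚ ≤ a → 0ℚ ≤ a ^ k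
  0≤^ zero    0≤a = 0≤1
  0≤^ (suc k) 0≤a = 0≤* 0≤a (0≤^ k 0≤a)

  0<^ : ∀ {a} k → 0ℚ < a → 0ℚ < a ^ k
  0<^ zero    0<a = positive⁻¹ 1ℚ
  0<^ (suc k) 0<a = 0<* 0<a (0<^ k 0<a)

  ^≤1 : ∀ {a} k → 0ℚ ≤ a → a ≤ 1ℚ → a ^ k ≤ 1ℚ
  ^≤1 zero        0≤a a≤1 = ≤-refl
  ^≤1 {a} (suc k) 0≤a a≤1 =
    ≤-trans (*-monoˡ-≤′ a 0≤a (^≤1 k 0≤a a≤1)) (subst (_≤ 1ℚ) (sym (*-identityʳ a)) a≤1)

  1≤^ : ∀ {a} k → 1ℚ ≤ a → 1ℚ ≤ a ^ k
  1≤^ zero        1≤a = ≤-refl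
  1≤^ {a} (suc k) 1≤a =
    ≤-trans (subst (_≤ a * 1ℚ) (*-identityˡ 1ℚ) (*-monoʳ-≤′ 1ℚ 0≤1 1≤a))
            (*-monoˡ-≤′ a (≤-trans 0≤1 1≤a) (1≤^ k 1≤a))

  *-^ : ∀ a b k → (a * b) ^ k ≡ a ^ k * b ^ k
  *-^ a b zero    = sym (*-identityˡ 1ℚ)
  *-^ a b (suc k) = trans (cong (a * b *_) (*-^ a b k)) (interchange a b (a ^ k) (b ^ k))
    where
    interchange : ∀ a b c d → a * b * (c * d) ≡ a * c * (b * d)
    interchange = solve 4 (λ a b c d → a :* b :* (c :* d) := a :* c :* (b :* d)) refl

  fromℕ-^ : ∀ m k → fromℕ (m ℕ.^ k) ≡ fromℕ m ^ k
  fromℕ-^ m zero    = +-identityʳ 1ℚ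
  fromℕ-^ m (suc k) = trans (fromℕ-* m (m ℕ.^ k)) (cong (fromℕ m *_) (fromℕ-^ m k))

  toℚᵘ-fromℕ : ∀ m → toℚᵘ (fromℕ m) ℚᵘ.≃ mkℚᵘ (ℤ.+ m) 0
  toℚᵘ-fromℕ zero    = ℚᵘₚ.≃-refl
  toℚᵘ-fromℕ (suc m) = ℚᵘₚ.≃-trans (toℚᵘ-homo-+ 1ℚ (fromℕ m))
    (ℚᵘₚ.≃-trans (ℚᵘₚ.+-congʳ (toℚᵘ 1ℚ) (toℚᵘ-fromℕ m)) (ℚᵘ.*≡* cross))
    where
    cross : (ℤ.1ℤ ℤ.* ℤ.1ℤ ℤ.+ ℤ.+ m ℤ.* ℤ.1ℤ) ℤ.* ℤ.1ℤ ≡ ℤ.+ suc m ℤ.* ℤ.1ℤ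
    cross rewrite ℤₚ.*-identityʳ (ℤ.1ℤ ℤ.* ℤ.1ℤ ℤ.+ ℤ.+ m ℤ.* ℤ.1ℤ) | ℤₚ.*-identityʳ (ℤ.+ m)
                | ℤₚ.*-identityʳ (ℤ.+ suc m) = sym (ℤₚ.pos-+ 1 m)

  fromℕ≤[a/b]*fromℕ : ∀ c a b m → c ℕ.* suc b ℕ.≤ a ℕ.* m → fromℕ c ≤ (ℤ.+ a / suc b) * fromℕ m
  fromℕ≤[a/b]*fromℕ c a b m cb≤am = toℚᵘ-cancel-≤
    (ℚᵘₚ.≤-respˡ-≃ (ℚᵘₚ.≃-sym (toℚᵘ-fromℕ c))
                   (ℚᵘₚ.≤-respʳ-≃ (ℚᵘₚ.≃-sym toℚᵘ-rhs) (ℚᵘ.*≤* cross)))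
    where
    toℚᵘ-rhs : toℚᵘ ((ℤ.+ a / suc b) * fromℕ m) ℚᵘ.≃ mkℚᵘ (ℤ.+ a) b ℚᵘ.* mkℚᵘ (ℤ.+ m) 0
    toℚᵘ-rhs = ℚᵘₚ.≃-trans (toℚᵘ-homo-* (ℤ.+ a / suc b) (fromℕ m))
                          (ℚᵘₚ.*-cong (toℚᵘ-fromℚᵘ (mkℚᵘ (ℤ.+ a) b)) (toℚᵘ-fromℕ m))
    cross : ℤ.+ c ℤ.* ℤ.+ suc (b ℕ.* 1) ℤ.≤ (ℤ.+ a ℤ.* ℤ.+ m) ℤ.* ℤ.1ℤ
    cross rewrite ℕₚ.*-identityʳ b | ℤₚ.*-identityʳ (ℤ.+ a ℤ.* ℤ.+ m)
                | sym (ℤₚ.pos-* a m) | sym (ℤₚ.pos-* c (suc b)) = ℤ.+≤+ cb≤am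

  archimedean : ∀ c ε → 0ℚ < ε → ∃ λ N → ∀ m → N ℕ.≤ m → fromℕ c ≤ ε * fromℕ m
  archimedean c (mkℚ (ℤ.+ 0) b _) 0<ε with drop-*<* 0<ε
  ... | ℤ.+<+ ()
  archimedean c (mkℚ ℤ.-[1+ a ] b _) 0<ε with drop-*<* 0<ε
  ... | ()
  archimedean c ε@(mkℚ ℤ.+[1+ a ] b _) 0<ε = c ℕ.* suc b , λ m N≤m →
    subst (λ ε → fromℕ c ≤ ε * fromℕ m) (↥p/↧p≡p ε)
          (fromℕ≤[a/b]*fromℕ c (suc a) b m (ℕₚ.≤-trans N≤m (ℕₚ.m≤n*m m (suc a))))

module Expectation where

  open import Data.Bool using (Bool; true; false)
  open import Data.List using (List; []; _∷_; _++_; map; foldr; length)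
  open import Data.Nat as ℕ using (ℕ; zero; suc)
  open import Data.Rational
  open import Data.Rational.Properties
  open import Data.Rational.Solver using (module +-*-Solver)
  open import Data.Vec using (Vec; []; _∷_)
  import Data.Vec as Vec
  open import Defs using (allVecs; tuples; maskProb; masksProb; sumℚ)
  open import Function using (_∘_)
  open import Relation.Binary.PropositionalEquality
  open +-*-Solver using (solve; _:+_; _:*_; _:-_; :-_; _:=_; con)
  open Arithmetic

  ∑ : {A : Set} → List A → (A → ℚ) → ℚ
  ∑ xs f = sumℚ (map f xs)

  ∑-++ : {A : Set} (xs ys : List A) (f : A → ℚ) → ∑ (xs ++ ys) f ≡ ∑ xs f + ∑ ys f
  ∑-++ []       ys f = sym (+-identityˡ (∑ ys f))
  ∑-++ (x ∷ xs) ys f = trans (cong (f x +_) (∑-++ xs ys f)) (sym (+-assoc (f x) (∑ xs f) (∑ ys f)))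

  ∑-map : {A B : Set} (xs : List A) (g : A → B) (f : B → ℚ) → ∑ (map g xs) f ≡ ∑ xs (f ∘ g)
  ∑-map []       g f = refl
  ∑-map (x ∷ xs) g f = cong (f (g x) +_) (∑-map xs g f)

  ∑-cong : {A : Set} (xs : List A) {f g : A → ℚ} → (∀ a → f a ≡ g a) → ∑ xs f ≡ ∑ xs g
  ∑-cong []       f≡g = refl
  ∑-cong (x ∷ xs) f≡g = cong₂ _+_ (f≡g x) (∑-cong xs f≡g)

  ∑-+ : {A : Set} (xs : List A) (f g : A → ℚ) → ∑ xs (λ a → f a + g a) ≡ ∑ xs f + ∑ xs g
  ∑-+ []       f g = refl
  ∑-+ (x ∷ xs) f g = trans (cong (f x + g x +_) (∑-+ xs f g)) (interchange (f x) (g x) (∑ xs f) (∑ xs g))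
    where
    interchange : ∀ a b c d → a + b + (c + d) ≡ a + c + (b + d)
    interchange = solve 4 (λ a b c d → a :+ b :+ (c :+ d) := a :+ c :+ (b :+ d)) refl

  ∑-*ˡ : {A : Set} (xs : List A) (c : ℚ) (f : A → ℚ) → ∑ xs (λ a → c * f a) ≡ c * ∑ xs f
  ∑-*ˡ []       c f = sym (*-zeroʳ c)
  ∑-*ˡ (x ∷ xs) c f = trans (cong (c * f x +_) (∑-*ˡ xs c f)) (sym (*-distribˡ-+ c (f x) (∑ xs f)))

  ∑-0 : {A : Set} (xs : List A) → ∑ xs (λ _ → 0ℚ) ≡ 0ℚ
  ∑-0 []       = refl
  ∑-0 (x ∷ xs) = trans (+-identityˡ _) (∑-0 xs)

  ∑-mono : {A : Set} (xs : List A) {f g : A → ℚ} → (∀ a → f a ≤ g a) → ∑ xs f ≤ ∑ xs g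
  ∑-mono []       f≤g = ≤-refl
  ∑-mono (x ∷ xs) f≤g = +-mono-≤ (f≤g x) (∑-mono xs f≤g)

  0≤∑ : {A : Set} (xs : List A) {f : A → ℚ} → (∀ a → 0ℚ ≤ f a) → 0ℚ ≤ ∑ xs f
  0≤∑ xs 0≤f = subst (_≤ ∑ xs _) (∑-0 xs) (∑-mono xs 0≤f)

  ∑-comm : {A B : Set} (xs : List A) (ys : List B) (f : A → B → ℚ) →
           ∑ xs (λ a → ∑ ys (f a)) ≡ ∑ ys (λ b → ∑ xs (λ a → f a b))
  ∑-comm []       ys f = sym (∑-0 ys)
  ∑-comm (x ∷ xs) ys f =
    trans (cong (∑ ys (f x) +_) (∑-comm xs ys f)) (sym (∑-+ ys (f x) (λ b → ∑ xs (λ a → f a b))))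

  ∑-≤-length* : {A : Set} (xs : List A) {f : A → ℚ} (c : ℚ) → (∀ a → f a ≤ c) →
                ∑ xs f ≤ fromℕ (length xs) * c
  ∑-≤-length* []       c f≤c = ≤-reflexive (sym (*-zeroˡ c))
  ∑-≤-length* (x ∷ xs) c f≤c =
    ≤-trans (+-mono-≤ (f≤c x) (∑-≤-length* xs c f≤c)) (≤-reflexive (distrib c (fromℕ (length xs))))
    where
    distrib : ∀ c m → c + m * c ≡ (1ℚ + m) * c
    distrib = solve 2 (λ c m → c :+ m :* c := (con 1ℚ :+ m) :* c) refl

  expect : {A : Set} → List A → (A → ℚ) → (A → ℚ) → ℚ
  expect xs w f = ∑ xs (λ a → w a * f a)

  module _ {A : Set} (xs : List A) (w : A → ℚ) where

    expect-cong : {f g : A → ℚ} → (∀ a → f a ≡ g a) → expect xs w f ≡ expect xs w g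
    expect-cong f≡g = ∑-cong xs (λ a → cong (w a *_) (f≡g a))

    expect-+ : (f g : A → ℚ) → expect xs w (λ a → f a + g a) ≡ expect xs w f + expect xs w g
    expect-+ f g = trans (∑-cong xs (λ a → *-distribˡ-+ (w a) (f a) (g a))) (∑-+ xs _ _)

    expect-*ˡ : (c : ℚ) (f : A → ℚ) → expect xs w (λ a → c * f a) ≡ c * expect xs w f
    expect-*ˡ c f = trans (∑-cong xs (λ a → swap (w a) c (f a))) (∑-*ˡ xs c _)
      where
      swap : ∀ a b c → a * (b * c) ≡ b * (a * c)
      swap = solve 3 (λ a b c → a :* (b :* c) := b :* (a :* c)) refl

    expect-const : (c : ℚ) → expect xs w (λ _ → c) ≡ ∑ xs w * c
    expect-const c = trans (∑-cong xs (λ a → *-comm (w a) c))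
                           (trans (∑-*ˡ xs c w) (*-comm c (∑ xs w)))

    expect-mono : (∀ a → 0ℚ ≤ w a) → {f g : A → ℚ} → (∀ a → f a ≤ g a) → expect xs w f ≤ expect xs w g
    expect-mono 0≤w f≤g = ∑-mono xs (λ a → *-monoˡ-≤′ (w a) (0≤w a) (f≤g a))

    expect-neg : (f : A → ℚ) → expect xs w (λ a → - f a) ≡ - expect xs w f
    expect-neg f = trans (expect-cong (λ a → neg≡-1* (f a)))
                         (trans (expect-*ˡ (- 1ℚ) f) (sym (neg≡-1* (expect xs w f))))
      where
      neg≡-1* : ∀ a → - a ≡ - 1ℚ * a
      neg≡-1* = solve 1 (λ a → :- a := :- con 1ℚ :* a) refl

    expect-sub : (f g : A → ℚ) → expect xs w (λ a → f a - g a) ≡ expect xs w f - expect xs w g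
    expect-sub f g = trans (expect-+ f (λ a → - g a)) (cong (expect xs w f +_) (expect-neg g))

    expect-∑ : {B : Set} (ys : List B) (f : A → B → ℚ) →
               expect xs w (λ a → ∑ ys (f a)) ≡ ∑ ys (λ b → expect xs w (λ a → f a b))
    expect-∑ ys f = trans (∑-cong xs (λ a → sym (∑-*ˡ ys (w a) (f a))))
                          (∑-comm xs ys (λ a b → w a * f a b))

  𝔼 : ℚ → (n : ℕ) → (Vec Bool n → ℚ) → ℚ
  𝔼 p n = expect (allVecs n) (maskProb p)

  𝔼ᵀ : ℚ → (n T : ℕ) → (Vec (Vec Bool n) T → ℚ) → ℚ
  𝔼ᵀ p n T = expect (tuples (allVecs n) T) (masksProb p)

  ∑-allVecs-suc : ∀ n (g : Vec Bool (suc n) → ℚ) →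
    ∑ (allVecs (suc n)) g ≡ ∑ (allVecs n) (g ∘ (true ∷_)) + ∑ (allVecs n) (g ∘ (false ∷_))
  ∑-allVecs-suc n g = trans (∑-++ (map (true ∷_) (allVecs n)) (map (false ∷_) (allVecs n)) g)
                            (cong₂ _+_ (∑-map (allVecs n) (true ∷_) g) (∑-map (allVecs n) (false ∷_) g))

  𝔼-suc : ∀ p n (f : Vec Bool (suc n) → ℚ) →
    𝔼 p (suc n) f ≡ (1ℚ - p) * 𝔼 p n (f ∘ (true ∷_)) + p * 𝔼 p n (f ∘ (false ∷_))
  𝔼-suc p n f = trans (∑-allVecs-suc n (λ s → maskProb p s * f s))
    (cong₂ _+_ (pull (1ℚ - p) (f ∘ (true ∷_))) (pull p (f ∘ (false ∷_))))
    where
    pull : ∀ c (g : Vec Bool n → ℚ) → ∑ (allVecs n) (λ s → c * maskProb p s * g s) ≡ c * 𝔼 p n g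
    pull c g = trans (∑-cong (allVecs n) (λ s → *-assoc c (maskProb p s) (g s))) (∑-*ˡ (allVecs n) c _)

  ∑-maskProb : ∀ p n → ∑ (allVecs n) (maskProb p) ≡ 1ℚ
  ∑-maskProb p zero    = +-identityʳ 1ℚ
  ∑-maskProb p (suc n) = begin
    ∑ (allVecs (suc n)) (maskProb p)
      ≡⟨ ∑-allVecs-suc n (maskProb p) ⟩
    ∑ (allVecs n) (λ s → (1ℚ - p) * maskProb p s) + ∑ (allVecs n) (λ s → p * maskProb p s)
      ≡⟨ cong₂ _+_ (∑-*ˡ (allVecs n) (1ℚ - p) (maskProb p)) (∑-*ˡ (allVecs n) p (maskProb p)) ⟩
    (1ℚ - p) * ∑ (allVecs n) (maskProb p) + p * ∑ (allVecs n) (maskProb p)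
      ≡⟨ cong (λ m → (1ℚ - p) * m + p * m) (∑-maskProb p n) ⟩
    (1ℚ - p) * 1ℚ + p * 1ℚ
      ≡⟨ total p ⟩
    1ℚ ∎
    where
    open ≡-Reasoning
    total : ∀ p → (1ℚ - p) * 1ℚ + p * 1ℚ ≡ 1ℚ
    total = solve 1 (λ p → (con 1ℚ :- p) :* con 1ℚ :+ p :* con 1ℚ := con 1ℚ) refl

  𝔼-const : ∀ p n c → 𝔼 p n (λ _ → c) ≡ c
  𝔼-const p n c = trans (expect-const (allVecs n) (maskProb p) c)
                        (trans (cong (_* c) (∑-maskProb p n)) (*-identityˡ c))

  ∑-tuples-suc : {A : Set} (xs : List A) (T : ℕ) (g : Vec A (suc T) → ℚ) →
    ∑ (tuples xs (suc T)) g ≡ ∑ xs (λ a → ∑ (tuples xs T) (g ∘ (a ∷_)))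
  ∑-tuples-suc xs T g = split xs
    where
    split : ∀ ys → ∑ (foldr (λ a acc → map (a ∷_) (tuples xs T) ++ acc) [] ys) g
                 ≡ ∑ ys (λ a → ∑ (tuples xs T) (g ∘ (a ∷_)))
    split []       = refl
    split (y ∷ ys) = trans (∑-++ (map (y ∷_) (tuples xs T)) _ g)
                           (cong₂ _+_ (∑-map (tuples xs T) (y ∷_) g) (split ys))

  𝔼ᵀ-suc : ∀ p n T (F : Vec (Vec Bool n) (suc T) → ℚ) →
    𝔼ᵀ p n (suc T) F ≡ 𝔼 p n (λ s → 𝔼ᵀ p n T (F ∘ (s ∷_)))
  𝔼ᵀ-suc p n T F = trans (∑-tuples-suc (allVecs n) T (λ ss → masksProb p ss * F ss))
    (∑-cong (allVecs n) λ s → trans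
      (∑-cong (tuples (allVecs n) T) (λ ss → *-assoc (maskProb p s) (masksProb p ss) (F (s ∷ ss))))
      (∑-*ˡ (tuples (allVecs n) T) (maskProb p s) _))

  𝔼ᵀ-const : ∀ p n T c → 𝔼ᵀ p n T (λ _ → c) ≡ c
  𝔼ᵀ-const p n zero    c = trans (+-identityʳ (1ℚ * c)) (*-identityˡ c)
  𝔼ᵀ-const p n (suc T) c = trans (𝔼ᵀ-suc p n T (λ _ → c))
    (trans (expect-cong (allVecs n) (maskProb p) (λ _ → 𝔼ᵀ-const p n T c)) (𝔼-const p n c))

  module _ {p : ℚ} (0≤p : 0ℚ ≤ p) (p≤1 : p ≤ 1ℚ) where

    0≤maskProb : ∀ {n} (s : Vec Bool n) → 0ℚ ≤ maskProb p s
    0≤maskProb []          = 0≤1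
    0≤maskProb (true ∷ s)  = 0≤* (p≤q⇒0≤q-p p≤1) (0≤maskProb s)
    0≤maskProb (false ∷ s) = 0≤* 0≤p (0≤maskProb s)

    0≤masksProb : ∀ {n T} (ss : Vec (Vec Bool n) T) → 0ℚ ≤ masksProb p ss
    0≤masksProb []       = 0≤1
    0≤masksProb (s ∷ ss) = 0≤* (0≤maskProb s) (0≤masksProb ss)

  ∑ᵛ : {A : Set} {T : ℕ} → (A → ℚ) → Vec A T → ℚ
  ∑ᵛ f []       = 0ℚ
  ∑ᵛ f (a ∷ as) = f a + ∑ᵛ f as

  ∑ᵛ-map : {A B : Set} {T : ℕ} (f : B → ℚ) (g : A → B) (as : Vec A T) →
           ∑ᵛ f (Vec.map g as) ≡ ∑ᵛ (f ∘ g) as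
  ∑ᵛ-map f g []       = refl
  ∑ᵛ-map f g (a ∷ as) = cong (f (g a) +_) (∑ᵛ-map f g as)

  ∑ᵛ-centre : {A : Set} {T : ℕ} (f : A → ℚ) (c : ℚ) (as : Vec A T) →
              ∑ᵛ f as - fromℕ T * c ≡ ∑ᵛ (λ a → f a - c) as
  ∑ᵛ-centre f c []       = trans (cong (λ z → 0ℚ - z) (*-zeroˡ c)) (+-inverseʳ 0ℚ)
  ∑ᵛ-centre {T = suc T} f c (a ∷ as) =
    trans (regroup (f a) (∑ᵛ f as) (fromℕ T) c) (cong (f a - c +_) (∑ᵛ-centre f c as))
    where
    regroup : ∀ x S t c → x + S - (1ℚ + t) * c ≡ x - c + (S - t * c)
    regroup = solve 4 (λ x S t c → x :+ S :- (con 1ℚ :+ t) :* c := x :- c :+ (S :- t :* c)) refl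

  module _ (p : ℚ) (n : ℕ) (f : Vec Bool n → ℚ) (centred : 𝔼 p n f ≡ 0ℚ) where

    𝔼ᵀ-∑ᵛ : ∀ T → 𝔼ᵀ p n T (∑ᵛ f) ≡ 0ℚ
    𝔼ᵀ-∑ᵛ zero    = trans (+-identityʳ (1ℚ * 0ℚ)) (*-zeroʳ 1ℚ)
    𝔼ᵀ-∑ᵛ (suc T) = begin
      𝔼ᵀ p n (suc T) (∑ᵛ f)                        ≡⟨ 𝔼ᵀ-suc p n T (∑ᵛ f) ⟩
      𝔼 p n (λ s → 𝔼ᵀ p n T (λ ss → f s + ∑ᵛ f ss)) ≡⟨ expect-cong (allVecs n) (maskProb p) step ⟩
      𝔼 p n f                                      ≡⟨ centred ⟩
      0ℚ                                           ∎
      where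
      open ≡-Reasoning
      step : ∀ s → 𝔼ᵀ p n T (λ ss → f s + ∑ᵛ f ss) ≡ f s
      step s = begin
        𝔼ᵀ p n T (λ ss → f s + ∑ᵛ f ss)           ≡⟨ expect-+ (tuples (allVecs n) T) (masksProb p) _ _ ⟩
        𝔼ᵀ p n T (λ _ → f s) + 𝔼ᵀ p n T (∑ᵛ f)   ≡⟨ cong₂ _+_ (𝔼ᵀ-const p n T (f s)) (𝔼ᵀ-∑ᵛ T) ⟩
        f s + 0ℚ                                 ≡⟨ +-identityʳ (f s) ⟩
        f s                                      ∎

    -- The cross terms vanish because the summands are independent and centred.
    𝔼ᵀ-∑ᵛ² : ∀ T → 𝔼ᵀ p n T (λ ss → ∑ᵛ f ss ²) ≡ fromℕ T * 𝔼 p n (λ s → f s ²)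
    𝔼ᵀ-∑ᵛ² zero    = trans (+-identityʳ (1ℚ * (0ℚ * 0ℚ))) (sym (*-zeroˡ (𝔼 p n (λ s → f s ²))))
    𝔼ᵀ-∑ᵛ² (suc T) = begin
      𝔼ᵀ p n (suc T) (λ ss → ∑ᵛ f ss ²)
        ≡⟨ 𝔼ᵀ-suc p n T _ ⟩
      𝔼 p n (λ s → 𝔼ᵀ p n T (λ ss → (f s + ∑ᵛ f ss) ²))
        ≡⟨ expect-cong (allVecs n) (maskProb p) step ⟩
      𝔼 p n (λ s → f s ² + fromℕ T * V)
        ≡⟨ expect-+ (allVecs n) (maskProb p) _ _ ⟩
      V + 𝔼 p n (λ _ → fromℕ T * V)
        ≡⟨ cong (V +_) (𝔼-const p n (fromℕ T * V)) ⟩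
      V + fromℕ T * V
        ≡⟨ distrib V (fromℕ T) ⟩
      (1ℚ + fromℕ T) * V ∎
      where
      open ≡-Reasoning
      V = 𝔼 p n (λ s → f s ²)
      distrib : ∀ v t → v + t * v ≡ (1ℚ + t) * v
      distrib = solve 2 (λ v t → v :+ t :* v := (con 1ℚ :+ t) :* v) refl
      square : ∀ x y → (x + y) * (x + y) ≡ x * x + (2ℚ * x * y + y * y)
      square = solve 2 (λ x y → (x :+ y) :* (x :+ y) := x :* x :+ (con 2ℚ :* x :* y :+ y :* y)) refl
      step : ∀ s → 𝔼ᵀ p n T (λ ss → (f s + ∑ᵛ f ss) ²) ≡ f s ² + fromℕ T * V
      step s = begin
        𝔼ᵀ p n T (λ ss → (f s + ∑ᵛ f ss) ²)
          ≡⟨ expect-cong (tuples (allVecs n) T) (masksProb p) (λ ss → square (f s) (∑ᵛ f ss)) ⟩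
        𝔼ᵀ p n T (λ ss → f s ² + (2ℚ * f s * ∑ᵛ f ss + ∑ᵛ f ss ²))
          ≡⟨ expect-+ (tuples (allVecs n) T) (masksProb p) _ _ ⟩
        𝔼ᵀ p n T (λ _ → f s ²) + 𝔼ᵀ p n T (λ ss → 2ℚ * f s * ∑ᵛ f ss + ∑ᵛ f ss ²)
          ≡⟨ cong₂ _+_ (𝔼ᵀ-const p n T (f s ²)) (expect-+ (tuples (allVecs n) T) (masksProb p) _ _) ⟩
        f s ² + (𝔼ᵀ p n T (λ ss → 2ℚ * f s * ∑ᵛ f ss) + 𝔼ᵀ p n T (λ ss → ∑ᵛ f ss ²))
          ≡⟨ cong₂ (λ a b → f s ² + (a + b))
                   (trans (expect-*ˡ (tuples (allVecs n) T) (masksProb p) (2ℚ * f s) (∑ᵛ f))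
                          (trans (cong (2ℚ * f s *_) (𝔼ᵀ-∑ᵛ T)) (*-zeroʳ (2ℚ * f s))))
                   (𝔼ᵀ-∑ᵛ² T) ⟩
        f s ² + (0ℚ + fromℕ T * V)
          ≡⟨ cong (f s ² +_) (+-identityˡ (fromℕ T * V)) ⟩
        f s ² + fromℕ T * V ∎

module Subsequences where

  open import Data.Bool using (Bool; true; false)
  open import Data.List using (List; []; _∷_; _++_; map; length)
  open import Data.Nat using (ℕ; zero; suc; _+_; _*_; _^_; _≤_; z≤n; s≤s)
  open import Data.Nat.Properties
  open import Data.Vec using (Vec; []; _∷_; toList)
  open import Data.Vec.Properties using (length-toList)
  open import Defs using (allVecs; subseq; eqBits; count; deck)
  open import Function using (_∘_)
  open import Relation.Binary.PropositionalEquality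

  δ : Bool → Bool → ℕ
  δ true  true  = 1
  δ false false = 1
  δ true  false = 0
  δ false true  = 0

  occurrences : List Bool → List Bool → ℕ
  occurrences []      y       = 1
  occurrences (c ∷ w) []      = 0
  occurrences (c ∷ w) (a ∷ y) = occurrences (c ∷ w) y + δ a c * occurrences w y

  count-++ : {A : Set} (P : A → Bool) (xs ys : List A) → count P (xs ++ ys) ≡ count P xs + count P ys
  count-++ P []       ys = refl
  count-++ P (x ∷ xs) ys with P x
  ... | true  = cong suc (count-++ P xs ys)
  ... | false = count-++ P xs ys

  count-map : {A B : Set} (P : B → Bool) (g : A → B) (xs : List A) → count P (map g xs) ≡ count (P ∘ g) xs
  count-map P g []       = refl
  count-map P g (x ∷ xs) with P (g x)
  ... | true  = cong suc (count-map P g xs)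
  ... | false = count-map P g xs

  count-false : {A : Set} {P : A → Bool} (xs : List A) → (∀ a → P a ≡ false) → count P xs ≡ 0
  count-false []           P≡false = refl
  count-false {P = P} (x ∷ xs) P≡false rewrite P≡false x = count-false xs P≡false

  count-subseq : ∀ n (x : Vec Bool n) v →
    count (λ s → eqBits (subseq s x) v) (allVecs n) ≡ occurrences v (toList x)
  count-subseq zero    []      []      = refl
  count-subseq zero    []      (c ∷ v) = refl
  count-subseq (suc n) (a ∷ x) v = begin
    count P (map (true ∷_) (allVecs n) ++ map (false ∷_) (allVecs n))
      ≡⟨ count-++ P (map (true ∷_) (allVecs n)) (map (false ∷_) (allVecs n)) ⟩
    count P (map (true ∷_) (allVecs n)) + count P (map (false ∷_) (allVecs n))
      ≡⟨ cong₂ _+_ (count-map P (true ∷_) (allVecs n))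
                   (trans (count-map P (false ∷_) (allVecs n)) (count-subseq n x v)) ⟩
    count (λ s → eqBits (a ∷ subseq s x) v) (allVecs n) + occurrences v (toList x)
      ≡⟨ with-head v ⟩
    occurrences v (a ∷ toList x) ∎
    where
    open ≡-Reasoning
    P : Vec Bool (suc n) → Bool
    P s = eqBits (subseq s (a ∷ x)) v
    with-head : ∀ v → count (λ s → eqBits (a ∷ subseq s x) v) (allVecs n) + occurrences v (toList x)
                      ≡ occurrences v (a ∷ toList x)
    with-head [] = cong (_+ 1) (count-false (allVecs n) (λ s → nonempty a (subseq s x)))
      where
      nonempty : ∀ a u → eqBits (a ∷ u) [] ≡ false
      nonempty true  u = refl
      nonempty false u = refl
    with-head (c ∷ v) = trans (cong (_+ occurrences (c ∷ v) (toList x)) (heads a c))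
                              (+-comm (δ a c * occurrences v (toList x)) (occurrences (c ∷ v) (toList x)))
      where
      heads : ∀ a c → count (λ s → eqBits (a ∷ subseq s x) (c ∷ v)) (allVecs n)
                      ≡ δ a c * occurrences v (toList x)
      heads true  true  = trans (count-subseq n x v) (sym (*-identityˡ _))
      heads false false = trans (count-subseq n x v) (sym (*-identityˡ _))
      heads true  false = count-false (allVecs n) (λ _ → refl)
      heads false true  = count-false (allVecs n) (λ _ → refl)

  deck≡occurrences : ∀ k {n} (x : Vec Bool n) (w : Vec Bool k) → deck k x w ≡ occurrences (toList w) (toList x)
  deck≡occurrences k {n} x w = count-subseq n x (toList w)

  δ*-≤ : ∀ a c m → δ a c * m ≤ m
  δ*-≤ true  true  m = ≤-reflexive (*-identityˡ m)
  δ*-≤ false false m = ≤-reflexive (*-identityˡ m)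
  δ*-≤ true  false m = z≤n
  δ*-≤ false true  m = z≤n

  occurrences-≤ : ∀ w y → occurrences w y ≤ length y ^ length w
  occurrences-≤ []      y       = ≤-refl
  occurrences-≤ (c ∷ w) []      = z≤n
  occurrences-≤ (c ∷ w) (a ∷ y) = begin
    occurrences (c ∷ w) y + δ a c * occurrences w y ≤⟨ +-mono-≤ (occurrences-≤ (c ∷ w) y)
                                                                 (≤-trans (δ*-≤ a c _) (occurrences-≤ w y)) ⟩
    m * m ^ k + m ^ k                                ≤⟨ +-mono-≤ (*-monoʳ-≤ m (^-monoˡ-≤ k (n≤1+n m)))
                                                                 (^-monoˡ-≤ k (n≤1+n m)) ⟩
    m * suc m ^ k + suc m ^ k                        ≡⟨ +-comm (m * suc m ^ k) (suc m ^ k) ⟩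
    suc m ^ suc k                                    ∎
    where
    open ≤-Reasoning
    m = length y
    k = length w

  length-subseq : ∀ {A : Set} {n} (s : Vec Bool n) (x : Vec A n) → length (subseq s x) ≤ n
  length-subseq []          []      = z≤n
  length-subseq (true ∷ s)  (a ∷ x) = s≤s (length-subseq s x)
  length-subseq (false ∷ s) (a ∷ x) = m≤n⇒m≤1+n (length-subseq s x)

  occurrences-≤-^ : ∀ {n k} (w : Vec Bool k) y → length y ≤ n → occurrences (toList w) y ≤ n ^ k
  occurrences-≤-^ {n} {k} w y |y|≤n = ≤-trans (occurrences-≤ (toList w) y)
    (subst (λ j → length y ^ j ≤ n ^ k) (sym (length-toList w)) (^-monoˡ-≤ k |y|≤n))

  deck-≤ : ∀ k {n} (x : Vec Bool n) (w : Vec Bool k) → deck k x w ≤ n ^ k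
  deck-≤ k x w = subst (_≤ _) (sym (deck≡occurrences k x w))
                       (occurrences-≤-^ w (toList x) (≤-reflexive (length-toList x)))

module Rounding where

  open import Data.Bool using (Bool; true; false; if_then_else_)
  open import Data.Empty using (⊥; ⊥-elim)
  open import Data.Nat as ℕ using (ℕ; zero; suc; s≤s; _≡ᵇ_)
  import Data.Nat.Properties as ℕₚ
  open import Data.Rational
  open import Data.Rational.Properties
  open import Data.Rational.Solver using (module +-*-Solver)
  open import Relation.Binary using (tri<; tri≈; tri>)
  open import Relation.Binary.PropositionalEquality
  open import Relation.Nullary using (Dec; yes; no; does; ¬_)
  open +-*-Solver using (solve; _:+_; _:*_; _:-_; :-_; _:=_; con)
  open Arithmetic

  -- d is consistent with the statistic S at scale y when S lies within y / 2 of y * d.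
  consistent : ℚ → ℚ → ℕ → Bool
  consistent y S d = does ((2ℚ * (S - y * fromℕ d)) ² <? y ²)

  lastBelow : (ℕ → Bool) → ℕ → ℕ
  lastBelow f zero    = 0
  lastBelow f (suc m) = if f m then m else lastBelow f m

  nearestMultiple : ℚ → ℕ → ℚ → ℕ
  nearestMultiple y B S = lastBelow (consistent y S) (suc B)

  miss : ℕ → ℕ → ℚ
  miss d D = if d ≡ᵇ D then 0ℚ else 1ℚ

  lastBelow-unique : ∀ f D m → (∀ d → f d ≡ true → d ≡ D) → f D ≡ true → D ℕ.< m → lastBelow f m ≡ D
  lastBelow-unique f D (suc m) unique fD D<1+m with f m in fm
  ... | true  = unique m fm
  ... | false = lastBelow-unique f D m unique fD (ℕₚ.≤∧≢⇒< (ℕₚ.≤-pred D<1+m) D≢m)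
    where
    D≢m : D ≢ m
    D≢m refl with () ← trans (sym fD) fm

  does⇒ : {A : Set} (a? : Dec A) → does a? ≡ true → A
  does⇒ (yes a) _ = a

  ¬does⇒ : {A : Set} (a? : Dec A) → does a? ≡ false → ¬ A
  ¬does⇒ (no ¬a) _ = ¬a

  consistent⇒< : ∀ y S d → consistent y S d ≡ true → (2ℚ * (S - y * fromℕ d)) ² < y ²
  consistent⇒< y S d = does⇒ ((2ℚ * (S - y * fromℕ d)) ² <? y ²)

  ¬consistent⇒≤ : ∀ y S d → consistent y S d ≡ false → y ² ≤ (2ℚ * (S - y * fromℕ d)) ²
  ¬consistent⇒≤ y S d c = ≮⇒≥ (¬does⇒ ((2ℚ * (S - y * fromℕ d)) ² <? y ²) c)

  -- Two consistent values d < D would give 2y(D - d) < 2y, yet D - d ≥ 1.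
  consistent-apart : ∀ y S → 0ℚ ≤ y → ∀ {d D} → d ℕ.< D →
                     consistent y S d ≡ true → consistent y S D ≡ true → ⊥
  consistent-apart y S 0≤y {d} {D} d<D cd cD = <-irrefl refl (<-≤-trans (+-mono-< ud<y -uD<y) 2y≤ud-uD)
    where
    u : ℕ → ℚ
    u e = 2ℚ * (S - y * fromℕ e)
    ud<y : u d < y
    ud<y = ²-<⇒< 0≤y (consistent⇒< y S d cd)
    -uD<y : - u D < y
    -uD<y = ²-<⇒< 0≤y (subst (_< y ²) (sym (neg² (u D))) (consistent⇒< y S D cD))
      where
      neg² : ∀ a → (- a) * (- a) ≡ a * a
      neg² = solve 1 (λ a → (:- a) :* (:- a) := a :* a) refl
    1≤D-d : 1ℚ ≤ fromℕ D - fromℕ d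
    1≤D-d = subst (_≤ fromℕ D - fromℕ d) (cancel (fromℕ d)) (+-monoˡ-≤ (- fromℕ d) (fromℕ-mono-≤ d<D))
      where
      cancel : ∀ a → 1ℚ + a - a ≡ 1ℚ
      cancel = solve 1 (λ a → con 1ℚ :+ a :- a := con 1ℚ) refl
    2y≤ud-uD : y + y ≤ u d + - u D
    2y≤ud-uD = begin
      y + y                          ≡⟨ double y ⟩
      (2ℚ * y) * 1ℚ                  ≤⟨ *-monoˡ-≤′ (2ℚ * y) (0≤* (+-mono-≤ 0≤1 0≤1) 0≤y) 1≤D-d ⟩
      (2ℚ * y) * (fromℕ D - fromℕ d) ≡⟨ spread S y (fromℕ d) (fromℕ D) ⟨
      u d + - u D                    ∎
      where
      open ≤-Reasoning
      double : ∀ y → y + y ≡ (2ℚ * y) * 1ℚ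
      double = solve 1 (λ y → y :+ y := (con 2ℚ :* y) :* con 1ℚ) refl
      spread : ∀ S y a b → 2ℚ * (S - y * a) + - (2ℚ * (S - y * b)) ≡ (2ℚ * y) * (b - a)
      spread = solve 4 (λ S y a b → con 2ℚ :* (S :- y :* a) :+ :- (con 2ℚ :* (S :- y :* b))
                                 := (con 2ℚ :* y) :* (b :- a)) refl

  consistent-unique : ∀ y S → 0ℚ ≤ y → ∀ d D →
                      consistent y S d ≡ true → consistent y S D ≡ true → d ≡ D
  consistent-unique y S 0≤y d D cd cD with ℕₚ.<-cmp d D
  ... | tri< d<D _ _ = ⊥-elim (consistent-apart y S 0≤y d<D cd cD)
  ... | tri≈ _ d≡D _ = d≡D
  ... | tri> _ _ D<d = ⊥-elim (consistent-apart y S 0≤y D<d cD cd)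

  miss-refl : ∀ D → miss D D ≡ 0ℚ
  miss-refl zero    = refl
  miss-refl (suc D) = miss-refl D

  miss≤1 : ∀ d D → miss d D ≤ 1ℚ
  miss≤1 d D with d ≡ᵇ D
  ... | true  = 0≤1
  ... | false = ≤-refl

  nearestMultiple-miss : ∀ y B S {D} → 0ℚ ≤ y → D ℕ.≤ B →
    y ² * miss (nearestMultiple y B S) D ≤ (2ℚ * (S - y * fromℕ D)) ²
  nearestMultiple-miss y B S {D} 0≤y D≤B with consistent y S D in cD
  ... | true  = begin
    y ² * miss (nearestMultiple y B S) D ≡⟨ cong (λ d → y ² * miss d D) exact ⟩
    y ² * miss D D                       ≡⟨ cong (y ² *_) (miss-refl D) ⟩
    y ² * 0ℚ                             ≡⟨ *-zeroʳ (y ²) ⟩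
    0ℚ                                   ≤⟨ 0≤² (2ℚ * (S - y * fromℕ D)) ⟩
    (2ℚ * (S - y * fromℕ D)) ²           ∎
    where
    open ≤-Reasoning
    exact : nearestMultiple y B S ≡ D
    exact = lastBelow-unique (consistent y S) D (suc B) (λ d cd → consistent-unique y S 0≤y d D cd cD) cD (s≤s D≤B)
  ... | false = begin
    y ² * miss (nearestMultiple y B S) D ≤⟨ *-monoˡ-≤′ (y ²) (0≤² y) (miss≤1 (nearestMultiple y B S) D) ⟩
    y ² * 1ℚ                             ≡⟨ *-identityʳ (y ²) ⟩
    y ²                                  ≤⟨ ¬consistent⇒≤ y S D cD ⟩
    (2ℚ * (S - y * fromℕ D)) ²           ∎
    where open ≤-Reasoning

module DeckEstimator where

  open import Data.Bool using (Bool; true; false; if_then_else_)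
  open import Data.List using (List; []; _∷_; _++_; map; length)
  import Data.List.Properties as List
  open import Data.Nat as ℕ using (ℕ; zero; suc)
  import Data.Nat.Properties as ℕₚ
  open import Data.Rational
  open import Data.Rational.Properties
  open import Data.Rational.Solver using (module +-*-Solver)
  open import Data.Vec using (Vec; []; _∷_; toList)
  import Data.Vec as Vec
  open import Data.Vec.Properties using (length-toList)
  open import Defs using (allVecs; tuples; subseq; deck; maskProb; masksProb; allB; correct; successProb; Estimator)
  open import Relation.Binary.PropositionalEquality
  open +-*-Solver using (solve; _:+_; _:*_; _:-_; :-_; _:=_; con)
  open Arithmetic
  open Expectation
  open Subsequences
  open Rounding

  -- Each occurrence of w in x survives the channel with probability (1 - p) ^ length w.
  𝔼-occurrences : ∀ p n (x : Vec Bool n) w →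
    𝔼 p n (λ s → fromℕ (occurrences w (subseq s x))) ≡ (1ℚ - p) ^ length w * fromℕ (occurrences w (toList x))
  𝔼-occurrences p zero    []      []      = refl
  𝔼-occurrences p zero    []      (c ∷ w) = sym (*-zeroʳ ((1ℚ - p) ^ suc (length w)))
  𝔼-occurrences p (suc n) (a ∷ x) []      = trans (𝔼-const p (suc n) (fromℕ 1)) (sym (*-identityˡ (fromℕ 1)))
  𝔼-occurrences p (suc n) (a ∷ x) (c ∷ w) = begin
    𝔼 p (suc n) (λ s → fromℕ (occurrences (c ∷ w) (subseq s (a ∷ x))))
      ≡⟨ 𝔼-suc p n _ ⟩
    (1ℚ - p) * 𝔼 p n (λ s → fromℕ (occurrences (c ∷ w) (subseq s x) ℕ.+ δ a c ℕ.* occurrences w (subseq s x)))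
      + p * 𝔼 p n (λ s → fromℕ (occurrences (c ∷ w) (subseq s x)))
      ≡⟨ cong₂ (λ u v → (1ℚ - p) * u + p * v) kept (𝔼-occurrences p n x (c ∷ w)) ⟩
    (1ℚ - p) * ((1ℚ - p) * P * O₁ + fromℕ (δ a c) * (P * O₂)) + p * ((1ℚ - p) * P * O₁)
      ≡⟨ collect p P O₁ O₂ (fromℕ (δ a c)) ⟩
    (1ℚ - p) * P * (O₁ + fromℕ (δ a c) * O₂)
      ≡⟨ cong ((1ℚ - p) * P *_) (sym (fromℕ-+δ* (toList x))) ⟩
    (1ℚ - p) * P * fromℕ (occurrences (c ∷ w) (toList x) ℕ.+ δ a c ℕ.* occurrences w (toList x)) ∎
    where
    open ≡-Reasoning
    P  = (1ℚ - p) ^ length w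
    O₁ = fromℕ (occurrences (c ∷ w) (toList x))
    O₂ = fromℕ (occurrences w (toList x))
    fromℕ-+δ* : ∀ y → fromℕ (occurrences (c ∷ w) y ℕ.+ δ a c ℕ.* occurrences w y)
                      ≡ fromℕ (occurrences (c ∷ w) y) + fromℕ (δ a c) * fromℕ (occurrences w y)
    fromℕ-+δ* y = trans (fromℕ-+ (occurrences (c ∷ w) y) _)
                        (cong (fromℕ (occurrences (c ∷ w) y) +_) (fromℕ-* (δ a c) (occurrences w y)))
    kept : 𝔼 p n (λ s → fromℕ (occurrences (c ∷ w) (subseq s x) ℕ.+ δ a c ℕ.* occurrences w (subseq s x)))
           ≡ (1ℚ - p) * P * O₁ + fromℕ (δ a c) * (P * O₂)
    kept = begin
      𝔼 p n (λ s → fromℕ (occurrences (c ∷ w) (subseq s x) ℕ.+ δ a c ℕ.* occurrences w (subseq s x)))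
        ≡⟨ expect-cong (allVecs n) (maskProb p) (λ s → fromℕ-+δ* (subseq s x)) ⟩
      𝔼 p n (λ s → fromℕ (occurrences (c ∷ w) (subseq s x)) + fromℕ (δ a c) * fromℕ (occurrences w (subseq s x)))
        ≡⟨ expect-+ (allVecs n) (maskProb p) _ _ ⟩
      𝔼 p n (λ s → fromℕ (occurrences (c ∷ w) (subseq s x)))
        + 𝔼 p n (λ s → fromℕ (δ a c) * fromℕ (occurrences w (subseq s x)))
        ≡⟨ cong₂ _+_ (𝔼-occurrences p n x (c ∷ w))
                     (trans (expect-*ˡ (allVecs n) (maskProb p) (fromℕ (δ a c)) _)
                            (cong (fromℕ (δ a c) *_) (𝔼-occurrences p n x w))) ⟩
      (1ℚ - p) * P * O₁ + fromℕ (δ a c) * (P * O₂) ∎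
    collect : ∀ p P O₁ O₂ d → (1ℚ - p) * ((1ℚ - p) * P * O₁ + d * (P * O₂)) + p * ((1ℚ - p) * P * O₁)
                             ≡ (1ℚ - p) * P * (O₁ + d * O₂)
    collect = solve 5 (λ p P O₁ O₂ d →
      (con 1ℚ :- p) :* ((con 1ℚ :- p) :* P :* O₁ :+ d :* (P :* O₂)) :+ p :* ((con 1ℚ :- p) :* P :* O₁)
        := (con 1ℚ :- p) :* P :* (O₁ :+ d :* O₂)) refl

  occurrenceTotal : ∀ {T} → Vec (List Bool) T → List Bool → ℚ
  occurrenceTotal ts w = ∑ᵛ (λ t → fromℕ (occurrences w t)) ts

  deckEstimator : ℚ → (n k T : ℕ) → Estimator k T
  deckEstimator p n k T ts w = nearestMultiple (fromℕ T * (1ℚ - p) ^ k) (n ℕ.^ k) (occurrenceTotal ts (toList w))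

  traces : ∀ {n T} → Vec Bool n → Vec (Vec Bool n) T → Vec (List Bool) T
  traces x ss = Vec.map (λ s → subseq s x) ss

  length-allVecs : ∀ k → length (allVecs k) ≡ 2 ℕ.^ k
  length-allVecs zero    = refl
  length-allVecs (suc k) = begin
    length (map (true ∷_) (allVecs k) ++ map (false ∷_) (allVecs k))
      ≡⟨ List.length-++ (map (true ∷_) (allVecs k)) ⟩
    length (map (true ∷_) (allVecs k)) ℕ.+ length (map (false ∷_) (allVecs k))
      ≡⟨ cong₂ ℕ._+_ (List.length-map (true ∷_) (allVecs k)) (List.length-map (false ∷_) (allVecs k)) ⟩
    length (allVecs k) ℕ.+ length (allVecs k)
      ≡⟨ cong (λ m → m ℕ.+ m) (length-allVecs k) ⟩
    2 ℕ.^ k ℕ.+ 2 ℕ.^ k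
      ≡⟨ cong (2 ℕ.^ k ℕ.+_) (sym (ℕₚ.+-identityʳ (2 ℕ.^ k))) ⟩
    2 ℕ.^ suc k ∎
    where open ≡-Reasoning

  union-bound-allB : {A : Set} (P : A → Bool) (xs : List A) →
                     1ℚ - ∑ xs (λ a → if P a then 0ℚ else 1ℚ) ≤ (if allB P xs then 1ℚ else 0ℚ)
  union-bound-allB P []       = ≤-refl
  union-bound-allB P (x ∷ xs) with P x
  ... | true  = subst (λ z → 1ℚ - z ≤ (if allB P xs then 1ℚ else 0ℚ))
                      (sym (+-identityˡ (∑ xs (λ a → if P a then 0ℚ else 1ℚ)))) (union-bound-allB P xs)
  ... | false = ≤-trans (≤-reflexive (cancel (∑ xs (λ a → if P a then 0ℚ else 1ℚ))))
                        (neg-antimono-≤ (0≤∑ xs (λ a → 0≤indicator (P a))))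
    where
    cancel : ∀ s → 1ℚ - (1ℚ + s) ≡ - s
    cancel = solve 1 (λ s → con 1ℚ :- (con 1ℚ :+ s) := :- s) refl
    0≤indicator : ∀ b → 0ℚ ≤ (if b then 0ℚ else 1ℚ)
    0≤indicator true  = ≤-refl
    0≤indicator false = 0≤1

  module _ {p : ℚ} (0≤p : 0ℚ ≤ p) (p≤1 : p ≤ 1ℚ) {n k T : ℕ} (x : Vec Bool n) where

    errorProb : Estimator k T → Vec Bool k → ℚ
    errorProb est w = 𝔼ᵀ p n T (λ ss → miss (est (traces x ss) w) (deck k x w))

    successProb-union-bound : ∀ est → 1ℚ - ∑ (allVecs k) (errorProb est) ≤ successProb n k p T est x
    successProb-union-bound est = begin
      1ℚ - ∑ (allVecs k) (errorProb est)
        ≡⟨ cong (λ e → 1ℚ - e) (sym (expect-∑ Ts (masksProb p) (allVecs k) errors)) ⟩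
      1ℚ - 𝔼ᵀ p n T (λ ss → ∑ (allVecs k) (errors ss))
        ≡⟨ cong (λ e → e - 𝔼ᵀ p n T (λ ss → ∑ (allVecs k) (errors ss))) (sym (𝔼ᵀ-const p n T 1ℚ)) ⟩
      𝔼ᵀ p n T (λ _ → 1ℚ) - 𝔼ᵀ p n T (λ ss → ∑ (allVecs k) (errors ss))
        ≡⟨ sym (expect-sub Ts (masksProb p) _ _) ⟩
      𝔼ᵀ p n T (λ ss → 1ℚ - ∑ (allVecs k) (errors ss))
        ≤⟨ ∑-mono Ts (λ ss → ≤-trans
             (*-monoˡ-≤′ (masksProb p ss) (0≤masksProb 0≤p p≤1 ss) (union-bound-allB _ (allVecs k)))
             (≤-reflexive (*-indicator (correct k (est (traces x ss)) x) (masksProb p ss)))) ⟩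
      successProb n k p T est x ∎
      where
      open ≤-Reasoning
      Ts = tuples (allVecs n) T
      errors : Vec (Vec Bool n) T → Vec Bool k → ℚ
      errors ss w = miss (est (traces x ss) w) (deck k x w)
      *-indicator : ∀ b m → m * (if b then 1ℚ else 0ℚ) ≡ (if b then m else 0ℚ)
      *-indicator true  m = *-identityʳ m
      *-indicator false m = *-zeroʳ m

    centredCount : Vec Bool k → Vec Bool n → ℚ
    centredCount w s = fromℕ (occurrences (toList w) (subseq s x)) - (1ℚ - p) ^ k * fromℕ (deck k x w)

    𝔼-centredCount : ∀ w → 𝔼 p n (centredCount w) ≡ 0ℚ
    𝔼-centredCount w = begin
      𝔼 p n (centredCount w)
        ≡⟨ expect-sub (allVecs n) (maskProb p) _ _ ⟩
      𝔼 p n (λ s → fromℕ (occurrences (toList w) (subseq s x))) - 𝔼 p n (λ _ → μD)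
        ≡⟨ cong₂ _-_ (𝔼-occurrences p n x (toList w)) (𝔼-const p n μD) ⟩
      (1ℚ - p) ^ length (toList w) * fromℕ (occurrences (toList w) (toList x)) - μD
        ≡⟨ cong₂ (λ j o → (1ℚ - p) ^ j * fromℕ o - μD) (length-toList w) (sym (deck≡occurrences k x w)) ⟩
      μD - μD
        ≡⟨ +-inverseʳ μD ⟩
      0ℚ ∎
      where
      open ≡-Reasoning
      μD = (1ℚ - p) ^ k * fromℕ (deck k x w)

    centredCount²≤ : ∀ w s → centredCount w s ² ≤ fromℕ (n ℕ.^ k) ²
    centredCount²≤ w s = ²-diff-≤ (0≤fromℕ (occurrences (toList w) (subseq s x)))
      (fromℕ-mono-≤ (occurrences-≤-^ w (subseq s x) (length-subseq s x)))
      (0≤* (0≤^ k (p≤q⇒0≤q-p p≤1)) (0≤fromℕ (deck k x w)))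
      (≤-trans (*-monoʳ-≤′ (fromℕ (deck k x w)) (0≤fromℕ (deck k x w)) (^≤1 k (p≤q⇒0≤q-p p≤1) (0≤p⇒1-p≤1 0≤p)))
               (subst (_≤ fromℕ (n ℕ.^ k)) (sym (*-identityˡ _)) (fromℕ-mono-≤ (deck-≤ k x w))))

    occurrenceTotal-deviation : ∀ w (ss : Vec (Vec Bool n) T) →
      occurrenceTotal (traces x ss) (toList w) - fromℕ T * (1ℚ - p) ^ k * fromℕ (deck k x w)
      ≡ ∑ᵛ (centredCount w) ss
    occurrenceTotal-deviation w ss = begin
      occurrenceTotal (traces x ss) (toList w) - fromℕ T * μ * fromℕ (deck k x w)
        ≡⟨ cong₂ _-_ (∑ᵛ-map (λ t → fromℕ (occurrences (toList w) t)) (λ s → subseq s x) ss)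
                     (*-assoc (fromℕ T) μ (fromℕ (deck k x w))) ⟩
      ∑ᵛ (λ s → fromℕ (occurrences (toList w) (subseq s x))) ss - fromℕ T * (μ * fromℕ (deck k x w))
        ≡⟨ ∑ᵛ-centre _ (μ * fromℕ (deck k x w)) ss ⟩
      ∑ᵛ (centredCount w) ss ∎
      where
      open ≡-Reasoning
      μ = (1ℚ - p) ^ k

    -- Chebyshev's inequality for the total number of occurrences of w in the traces.
    deckEstimator-error : ∀ w → (fromℕ T * (1ℚ - p) ^ k) ² * errorProb (deckEstimator p n k T) w
                                ≤ 2ℚ ² * (fromℕ T * fromℕ (n ℕ.^ k) ²)
    deckEstimator-error w = begin
      y ² * errorProb (deckEstimator p n k T) w
        ≡⟨ expect-*ˡ Ts (masksProb p) (y ²) _ ⟨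
      𝔼ᵀ p n T (λ ss → y ² * miss (deckEstimator p n k T (traces x ss) w) (deck k x w))
        ≤⟨ expect-mono Ts (masksProb p) (0≤masksProb 0≤p p≤1) (λ ss →
             nearestMultiple-miss y (n ℕ.^ k) (occurrenceTotal (traces x ss) (toList w)) 0≤y (deck-≤ k x w)) ⟩
      𝔼ᵀ p n T (λ ss → (2ℚ * (occurrenceTotal (traces x ss) (toList w) - y * fromℕ (deck k x w))) ²)
        ≡⟨ expect-cong Ts (masksProb p) (λ ss → cong (λ z → (2ℚ * z) ²) (occurrenceTotal-deviation w ss)) ⟩
      𝔼ᵀ p n T (λ ss → (2ℚ * ∑ᵛ (centredCount w) ss) ²)
        ≡⟨ expect-cong Ts (masksProb p) (λ ss → *-² 2ℚ (∑ᵛ (centredCount w) ss)) ⟩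
      𝔼ᵀ p n T (λ ss → 2ℚ ² * ∑ᵛ (centredCount w) ss ²)
        ≡⟨ expect-*ˡ Ts (masksProb p) (2ℚ ²) _ ⟩
      2ℚ ² * 𝔼ᵀ p n T (λ ss → ∑ᵛ (centredCount w) ss ²)
        ≡⟨ cong (2ℚ ² *_) (𝔼ᵀ-∑ᵛ² p n (centredCount w) (𝔼-centredCount w) T) ⟩
      2ℚ ² * (fromℕ T * 𝔼 p n (λ s → centredCount w s ²))
        ≤⟨ *-monoˡ-≤′ (2ℚ ²) (0≤² 2ℚ) (*-monoˡ-≤′ (fromℕ T) (0≤fromℕ T)
             (≤-trans (expect-mono (allVecs n) (maskProb p) (0≤maskProb 0≤p p≤1) (centredCount²≤ w))
                      (≤-reflexive (𝔼-const p n (fromℕ (n ℕ.^ k) ²))))) ⟩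
      2ℚ ² * (fromℕ T * fromℕ (n ℕ.^ k) ²) ∎
      where
      open ≤-Reasoning
      Ts = tuples (allVecs n) T
      y = fromℕ T * (1ℚ - p) ^ k
      0≤y : 0ℚ ≤ y
      0≤y = 0≤* (0≤fromℕ T) (0≤^ k (p≤q⇒0≤q-p p≤1))
      *-² : ∀ a b → (a * b) * (a * b) ≡ a * a * (b * b)
      *-² = solve 2 (λ a b → (a :* b) :* (a :* b) := a :* a :* (b :* b)) refl

    deckEstimator-succeeds : ∀ ε → 0ℚ < fromℕ T * (1ℚ - p) ^ k →
      fromℕ (2 ℕ.^ k) * (2ℚ ² * (fromℕ T * fromℕ (n ℕ.^ k) ²)) ≤ (fromℕ T * (1ℚ - p) ^ k) ² * ε →
      1ℚ - ε ≤ successProb n k p T (deckEstimator p n k T) x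
    deckEstimator-succeeds ε 0<y budget =
      ≤-trans (+-monoʳ-≤ 1ℚ (neg-antimono-≤ errors≤ε)) (successProb-union-bound (deckEstimator p n k T))
      where
      y = fromℕ T * (1ℚ - p) ^ k
      errors = ∑ (allVecs k) (errorProb (deckEstimator p n k T))
      bound = 2ℚ ² * (fromℕ T * fromℕ (n ℕ.^ k) ²)
      y²errors≤ : y ² * errors ≤ fromℕ (2 ℕ.^ k) * (2ℚ ² * (fromℕ T * fromℕ (n ℕ.^ k) ²))
      y²errors≤ = ≤-trans (≤-reflexive (sym (∑-*ˡ (allVecs k) (y ²) _)))
        (subst (λ m → ∑ (allVecs k) (λ w → y ² * errorProb (deckEstimator p n k T) w) ≤ fromℕ m * bound)
               (length-allVecs k) (∑-≤-length* (allVecs k) bound deckEstimator-error))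
      errors≤ε : errors ≤ ε
      errors≤ε = *-cancelˡ-≤-pos (y ²) {{positive (0<* 0<y 0<y)}} (≤-trans y²errors≤ budget)

module Parameters where

  open import Data.Bool using (Bool; true; false; if_then_else_)
  import Data.Integer as ℤ
  open import Data.Nat as ℕ using (ℕ; zero; suc)
  import Data.Nat.Properties as ℕₚ
  open import Data.Product using (∃-syntax; _×_; _,_)
  open import Data.Rational
  open import Data.Rational.Properties
  open import Data.Rational.Solver using (module +-*-Solver)
  open import Data.Vec using (Vec; [])
  open import Defs using (successProb; deck)
  open import Relation.Binary.PropositionalEquality
  open +-*-Solver using (solve; _:*_; _:-_; _:^_; _:=_; con)
  open Arithmetic
  open Subsequences
  open DeckEstimator

  -- With μ b ≥ 1 and T = b ^ 6 the Chebyshev bound 4 T b² / (T μ)² per word is at most 4 / b²,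
  -- and the 2 ^ k words together fail with probability at most 4 · 2 ^ k / b² ≤ ε.
  error-budget : ∀ {P ε b μ} → 0ℚ ≤ ε → 0ℚ ≤ b → 1ℚ ≤ μ * b → 2ℚ ² * P ≤ ε * b ² →
                 P * (2ℚ ² * (b ^ 6 * b ²)) ≤ (b ^ 6 * μ) ² * ε
  error-budget {P} {ε} {b} {μ} 0≤ε 0≤b 1≤μb 4P≤εb² = begin
    P * (2ℚ ² * (b ^ 6 * b ²))          ≡⟨ regroup P b ⟩
    2ℚ ² * P * (b ^ 6 * b ²)            ≤⟨ *-monoʳ-≤′ (b ^ 6 * b ²) (0≤* (0≤^ 6 0≤b) (0≤² b)) 4P≤εb² ⟩
    ε * b ² * (b ^ 6 * b ²)             ≡⟨ *-identityʳ _ ⟨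
    ε * b ² * (b ^ 6 * b ²) * 1ℚ        ≤⟨ *-monoˡ-≤′ _ 0≤εb¹⁰ 1≤[μb]² ⟩
    ε * b ² * (b ^ 6 * b ²) * (μ * b) ² ≡⟨ regroup′ ε b μ ⟩
    (b ^ 6 * μ) ² * ε                   ∎
    where
    open ≤-Reasoning
    0≤εb¹⁰ : 0ℚ ≤ ε * b ² * (b ^ 6 * b ²)
    0≤εb¹⁰ = 0≤* (0≤* 0≤ε (0≤² b)) (0≤* (0≤^ 6 0≤b) (0≤² b))
    1≤[μb]² : 1ℚ ≤ (μ * b) ²
    1≤[μb]² = ≤-trans 1≤μb (subst (_≤ (μ * b) ²) (*-identityʳ (μ * b))
                                  (*-monoˡ-≤′ (μ * b) (≤-trans 0≤1 1≤μb) 1≤μb))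
    regroup : ∀ P b → P * (2ℚ * 2ℚ * (b ^ 6 * (b * b))) ≡ 2ℚ * 2ℚ * P * (b ^ 6 * (b * b))
    regroup = solve 2 (λ P b → P :* (con 2ℚ :* con 2ℚ :* (b :^ 6 :* (b :* b)))
                            := con 2ℚ :* con 2ℚ :* P :* (b :^ 6 :* (b :* b))) refl
    regroup′ : ∀ ε b μ → ε * (b * b) * (b ^ 6 * (b * b)) * ((μ * b) * (μ * b)) ≡ (b ^ 6 * μ) * (b ^ 6 * μ) * ε
    regroup′ = solve 3 (λ ε b μ → ε :* (b :* b) :* (b :^ 6 :* (b :* b)) :* ((μ :* b) :* (μ :* b))
                              := (b :^ 6 :* μ) :* (b :^ 6 :* μ) :* ε) refl

  p≤1-r⇒r≤1-p : ∀ {p r} → p ≤ 1ℚ - r → r ≤ 1ℚ - p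
  p≤1-r⇒r≤1-p {p} {r} p≤1-r = subst (_≤ 1ℚ - p) (flip r) (+-monoʳ-≤ 1ℚ (neg-antimono-≤ p≤1-r))
    where
    flip : ∀ r → 1ℚ - (1ℚ - r) ≡ r
    flip = solve 1 (λ r → con 1ℚ :- (con 1ℚ :- r) := r) refl

  2ᵏ*n≤[nᵏ]² : ∀ n k → 2 ℕ.≤ n → 1 ℕ.≤ k → 2 ℕ.^ k ℕ.* n ℕ.≤ n ℕ.^ k ℕ.* n ℕ.^ k
  2ᵏ*n≤[nᵏ]² n@(suc _) (suc k) 2≤n _ =
    ℕₚ.*-mono-≤ (ℕₚ.^-monoˡ-≤ (suc k) 2≤n) (ℕₚ.m≤m*n n (n ℕ.^ k) {{ℕₚ.m^n≢0 n k}})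

  deckEstimator-reconstructs : ∀ ε → 0ℚ ≤ ε → ∀ n .{{_ : ℕ.NonZero n}} → 2 ℕ.≤ n → fromℕ 4 ≤ ε * fromℕ n →
    ∀ k → 1 ℕ.≤ k → ∀ p → 0ℚ ≤ p → p ≤ 1ℚ - ℤ.+ k / n → (x : Vec Bool n) →
    1ℚ - ε ≤ successProb n k p ((n ℕ.^ k) ℕ.^ 6) (deckEstimator p n k ((n ℕ.^ k) ℕ.^ 6)) x
  deckEstimator-reconstructs ε 0≤ε n@(suc n′) 2≤n 4≤εn k 1≤k p 0≤p p≤1-k/n x =
    deckEstimator-succeeds 0≤p p≤1 {n} {k} {T} x ε 0<y
      (subst (λ t → fromℕ (2 ℕ.^ k) * (2ℚ ² * (t * fromℕ B ²)) ≤ (t * μ) ² * ε) (sym (fromℕ-^ B 6))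
             (error-budget {fromℕ (2 ℕ.^ k)} 0≤ε (0≤fromℕ B) 1≤μB 4·2ᵏ≤εB²))
    where
    B = n ℕ.^ k
    T = B ℕ.^ 6
    q = 1ℚ - p
    μ = q ^ k
    1≤qn : 1ℚ ≤ q * fromℕ n
    1≤qn = ≤-trans (fromℕ≤[a/b]*fromℕ 1 k n′ n (ℕₚ.*-monoˡ-≤ n 1≤k))
                   (*-monoʳ-≤′ (fromℕ n) (0≤fromℕ n) (p≤1-r⇒r≤1-p {p} {ℤ.+ k / n} p≤1-k/n))
    0<q : 0ℚ < q
    0<q = 1≤*⇒0< (0≤fromℕ n) 1≤qn
    p≤1 : p ≤ 1ℚ
    p≤1 = 0≤q-p⇒p≤q (<⇒≤ 0<q)
    0<y : 0ℚ < fromℕ T * μ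
    0<y = 0<* (<-≤-trans (positive⁻¹ 1ℚ) (fromℕ-mono-≤ (ℕₚ.m^n>0 B {{ℕₚ.m^n≢0 n k}} 6))) (0<^ k 0<q)
    1≤μB : 1ℚ ≤ μ * fromℕ B
    1≤μB = subst (1ℚ ≤_) (trans (*-^ q (fromℕ n) k) (cong (μ *_) (sym (fromℕ-^ n k)))) (1≤^ k 1≤qn)
    4·2ᵏ≤εB² : 2ℚ ² * fromℕ (2 ℕ.^ k) ≤ ε * fromℕ B ²
    4·2ᵏ≤εB² = begin
      2ℚ ² * fromℕ (2 ℕ.^ k)          ≤⟨ *-monoʳ-≤′ (fromℕ (2 ℕ.^ k)) (0≤fromℕ (2 ℕ.^ k)) 4≤εn ⟩
      ε * fromℕ n * fromℕ (2 ℕ.^ k)   ≡⟨ swap ε (fromℕ n) (fromℕ (2 ℕ.^ k)) ⟩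
      ε * (fromℕ (2 ℕ.^ k) * fromℕ n) ≡⟨ cong (ε *_) (fromℕ-* (2 ℕ.^ k) n) ⟨
      ε * fromℕ (2 ℕ.^ k ℕ.* n)       ≤⟨ *-monoˡ-≤′ ε 0≤ε (fromℕ-mono-≤ (2ᵏ*n≤[nᵏ]² n k 2≤n 1≤k)) ⟩
      ε * fromℕ (B ℕ.* B)             ≡⟨ cong (ε *_) (fromℕ-* B B) ⟩
      ε * fromℕ B ²                   ∎
      where
      open ≤-Reasoning
      swap : ∀ a b c → a * b * c ≡ a * (c * b)
      swap = solve 3 (λ a b c → a :* b :* c := a :* (c :* b)) refl

  successProb-deck₀ : ∀ n p (x : Vec Bool n) → successProb n 0 p 0 (λ _ _ → 1) x ≡ 1ℚ
  successProb-deck₀ n p x = exact (deck 0 x []) (deck≡occurrences 0 x [])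
    where
    exact : ∀ d → d ≡ 1 → (if (if 1 ℕ.≡ᵇ d then true else false) then 1ℚ else 0ℚ) + 0ℚ ≡ 1ℚ
    exact .1 refl = refl

  deck-reconstruction : ∀ ε → 0ℚ ≤ ε → ∀ n .{{_ : ℕ.NonZero n}} → 2 ℕ.≤ n → fromℕ 4 ≤ ε * fromℕ n →
    ∀ k p → 0ℚ ≤ p → p ≤ 1ℚ - ℤ.+ k / n →
    ∃[ T ] (T ℕ.≤ n ℕ.^ (6 ℕ.* k) × ∃[ est ] ((x : Vec Bool n) → 1ℚ - ε ≤ successProb n k p T est x))
  deck-reconstruction ε 0≤ε n 2≤n 4≤εn zero p 0≤p _ =
    0 , ℕ.z≤n , (λ _ _ → 1) ,
    λ x → subst (1ℚ - ε ≤_) (sym (successProb-deck₀ n p x)) (+-monoʳ-≤ 1ℚ (neg-antimono-≤ 0≤ε))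
  deck-reconstruction ε 0≤ε n 2≤n 4≤εn k@(suc _) p 0≤p p≤1-k/n =
    T , ℕₚ.≤-reflexive (trans (ℕₚ.^-*-assoc n k 6) (cong (n ℕ.^_) (ℕₚ.*-comm k 6))) ,
    deckEstimator p n k T , deckEstimator-reconstructs ε 0≤ε n 2≤n 4≤εn k (ℕ.s≤s ℕ.z≤n) p 0≤p p≤1-k/n
    where
    T = (n ℕ.^ k) ℕ.^ 6

open import Defs
open import Data.Nat using (ℕ; _≤_; _^_; _*_; _+_; NonZero)
open import Data.Nat.Properties using (≤-trans; m≤m+n; m≤n+m)
open import Data.Integer using (+_)
open import Data.Rational using (ℚ; 0ℚ; 1ℚ; _-_; _/_) renaming (_≤_ to _≤ℚ_; _<_ to _<ℚ_)
open import Data.Rational.Properties using (<⇒≤)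
open import Data.Vec using (Vec)
open import Data.Bool using (Bool)
open import Data.Product using (∃-syntax; _×_; _,_)
open Arithmetic using (archimedean)
open Parameters using (deck-reconstruction)

theorem12 : ∃[ C ] ((ε : ℚ) → 0ℚ <ℚ ε → ∃[ N ] ((n : ℕ) → N ≤ n → {{_ : NonZero n}} →
                (k : ℕ) → k ≤ n → (p : ℚ) → 0ℚ ≤ℚ p → p ≤ℚ 1ℚ - (+ k / n) →
                ∃[ T ] (T ≤ n ^ (C * k) × ∃[ est ] ((x : Vec Bool n) →
                  1ℚ - ε ≤ℚ successProb n k p T est x))))
theorem12 = 6 , λ ε 0<ε →
  let N₀ , 4≤εm = archimedean 4 ε 0<ε in
  N₀ + 2 , λ n N₀+2≤n k _ p 0≤p p≤1-k/n →
    deck-reconstruction ε (<⇒≤ 0<ε) n (≤-trans (m≤n+m 2 N₀) N₀+2≤n)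
                        (4≤εm n (≤-trans (m≤m+n N₀ 2) N₀+2≤n)) k p 0≤p p≤1-k/n
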